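{- Let $\Gamma$ be a formula. If $\Gamma$ has an $\mathsf{SBC}^-$ proof of size $N$, then $\Gamma$ has an $\mathsf{SBC}^-$ proof of size at most $N$ in which all of the set-blocked clause addition steps are performed before any resolution or weakening steps.
   Context: A literal is a variable $v$ or its negation $\bar v$. A clause is a nontautological set of literals (no complementary pair), read as a disjunction; $\bot$ is the empty clause; a formula is a finite set of clauses; $\mathrm{var}(\Gamma)$ is the set of variables occurring in $\Gamma$. For a set $L$ of literals, $\bar L=\{\bar\ell:\ell\in L\}$. A clause $D$ is a weakening of $C$ if $C\subseteq D$. If $C\cup\{x\}$ and $D\cup\{\bar x\}$ are clauses with $x,\bar x\notin C\cup D$ and $C\cup D$ nontautological, then $C\cup D$ is their resolvent on $x$. A clause $C$ is a set-blocked clause (SBC) for a nonempty $L\subseteq C$ with respect to a formula $\Gamma$ if for every $D\in\Gamma$ with $D\cap\bar L\neq\varnothing$ and $D\cap L=\varnothing$, the set $(C\setminus L)\cup(D\setminus\bar L)$ is tautological. An $\mathsf{SBC}$ proof of $\Gamma$ is a sequence of formulas $(\Gamma_1,\dots,\Gamma_N)$ with $\Gamma_1=\Gamma$, $\bot\in\Gamma_N$, and for each $i<N$, $\Gamma_{i+1}=\Gamma_i\cup\{C\}$ where $C$ is a resolvent of two clauses of $\Gamma_i$ (resolution step), a weakening of a clause of $\Gamma_i$ (weakening step), or an SBC with respect to $\Gamma_i$ (set-blocked clause addition step). Its size is $N$. An $\mathsf{SBC}^-$ proof of $\Gamma$ is one in which every variable occurring in the proof belongs to $\mathrm{var}(\Gamma)$.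 -}

module Defs where

open import Data.Nat using (ℕ; _≤_)
open import Data.Bool using (Bool; true; false; not)
open import Data.Product using (Σ; ∃; ∃-syntax; _×_; _,_; proj₁)
open import Data.Sum using (_⊎_)
open import Data.List using (List; []; _∷_; _++_; length)
open import Data.List.Membership.Propositional using (_∈_; _∉_)
open import Data.List.Relation.Unary.All using (All)
open import Relation.Binary.PropositionalEquality using (_≡_; _≢_)
open import Relation.Nullary using (¬_)

-- Variables are natural numbers; a literal is (v , true) = v or (v , false) = v̄.
Var : Set
Var = ℕ

Lit : Set
Lit = Var × Bool

var : Lit → Var
var = proj₁

neg : Lit → Lit
neg (v , b) = (v , not b)

-- Clauses (finite sets of literals) are represented by lists read as sets:
-- all notions below only depend on list membership.
Clause : Set
Clause = List Lit

Formula : Set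
Formula = List Clause

TautP : (Lit → Set) → Set
TautP P = ∃[ ℓ ] (P ℓ × P (neg ℓ))

Taut : Clause → Set
Taut C = TautP (λ ℓ → ℓ ∈ C)

IsClause : Clause → Set
IsClause C = ¬ Taut C

_⊆ˡ_ : Clause → Clause → Set
C ⊆ˡ D = ∀ {ℓ} → ℓ ∈ C → ℓ ∈ D

_≈ˡ_ : Clause → Clause → Set
C ≈ˡ D = (C ⊆ˡ D) × (D ⊆ˡ C)

_∈ᶠ_ : Clause → Formula → Set
C ∈ᶠ Γ = ∃[ D ] (D ∈ Γ × D ≈ˡ C)

HasEmpty : Formula → Set
HasEmpty Γ = [] ∈ᶠ Γ

InVars : Var → Formula → Set
InVars v Γ = ∃[ C ] (C ∈ Γ × ∃[ ℓ ] (ℓ ∈ C × var ℓ ≡ v))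

Resolvent : Formula → Clause → Set
Resolvent Γ R =
  ∃[ C ] ∃[ D ] ∃[ x ]
    ( ((x ∷ C) ∈ᶠ Γ) × ((neg x ∷ D) ∈ᶠ Γ)
    × (x ∉ C ++ D) × (neg x ∉ C ++ D)
    × IsClause (C ++ D)
    × (R ≈ˡ (C ++ D)) )

Weakening : Formula → Clause → Set
Weakening Γ D = IsClause D × ∃[ C ] (C ∈ Γ × C ⊆ˡ D)

SetBlockedFor : Formula → Clause → List Lit → Set
SetBlockedFor Γ C L =
  (∃[ ℓ ] (ℓ ∈ L)) × (L ⊆ˡ C) ×
  (∀ D → D ∈ Γ →
     (∃[ ℓ ] (ℓ ∈ L × neg ℓ ∈ D)) →
     (¬ (∃[ ℓ ] (ℓ ∈ L × ℓ ∈ D))) →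
     TautP (λ m → (m ∈ C × m ∉ L) ⊎ (m ∈ D × neg m ∉ L)))

SBC : Formula → Clause → Set
SBC Γ C = IsClause C × ∃[ L ] SetBlockedFor Γ C L

data Kind : Set where
  res weak sbc : Kind

Step : Kind → Formula → Clause → Set
Step res  Γ C = Resolvent Γ C
Step weak Γ C = Weakening Γ C
Step sbc  Γ C = SBC Γ C

-- The proof (Γ_1, …, Γ_N) corresponds to Γ_1 = Γ and Γ_{i+1} = Γ_i ∪ {C_i},
-- so its size is N = length steps + 1.
data Derivation : Formula → List (Kind × Clause) → Set where
  done : ∀ {Δ} → Derivation Δ []
  step : ∀ {Δ k C ss} → Step k Δ C → Derivation (C ∷ Δ) ss →
         Derivation Δ ((k , C) ∷ ss)

added : List (Kind × Clause) → Formula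
added [] = []
added ((_ , C) ∷ ss) = C ∷ added ss

IsSBCProof : Formula → List (Kind × Clause) → Set
IsSBCProof Γ ss = Derivation Γ ss × HasEmpty (added ss ++ Γ)

IsSBC⁻Proof : Formula → List (Kind × Clause) → Set
IsSBC⁻Proof Γ ss =
  IsSBCProof Γ ss ×
  All (λ C → ∀ {ℓ} → ℓ ∈ C → InVars (var ℓ) Γ) (added ss)

size : List (Kind × Clause) → ℕ
size ss = Data.Nat.suc (length ss)

SBCFirst : List (Kind × Clause) → Set
SBCFirst ss = ∃[ xs ] ∃[ ys ]
  ( (ss ≡ xs ++ ys)
  × All (λ s → proj₁ s ≡ sbc) xs
  × All (λ s → proj₁ s ≢ sbc) ys )

-- Set-blocked clause addition is antimonotone in the formula (blockedness only
-- quantifies over the clauses present), while resolution and weakening are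
-- monotone. So moving every SBC step of a proof to the front keeps it valid:
-- each SBC step is then checked against a subset of the clauses it originally
-- saw, and each other step against a superset. The reordering is a permutation
-- of the steps, so the size, the set of derived clauses (in particular ⊥) and
-- the variables used are unchanged.
module Submission where

open import Defs
open import Data.Nat using (ℕ; _≤_; suc)
open import Data.Nat.Properties using (≤-reflexive)
open import Data.Product using (∃-syntax; _×_; _,_; proj₁)
open import Data.List using (List; []; _∷_; _++_; _ʳ++_; filter)
open import Data.List.Relation.Unary.All using (All)
open import Data.List.Relation.Unary.All.Properties using (all-filter)
open import Data.List.Relation.Binary.Subset.Propositional using (_⊆_)
open import Data.List.Relation.Binary.Subset.Propositional.Properties
  using (⊆-refl; ⊆-trans; ⊆-reflexive-↭; xs⊆x∷xs; ∷⁺ʳ; ∈-∷⁺ʳ; xs⊆xs++ys; xs⊆ys++xs)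
open import Data.List.Relation.Binary.Permutation.Propositional
  using (_↭_; ↭-refl; ↭-prep; ↭-swap; ↭-trans; ↭-sym)
open import Data.List.Relation.Binary.Permutation.Propositional.Properties
  using (∈-resp-↭; All-resp-↭; ↭-length; ++⁺ʳ; shift; ++↭ʳ++)
open import Data.List.Relation.Unary.Any using (here)
open import Relation.Unary using (Pred; Decidable)
open import Relation.Unary.Properties using (∁?)
open import Relation.Nullary using (yes; no)
open import Relation.Binary.PropositionalEquality using (_≡_; refl; sym; trans; cong)

Steps : Set
Steps = List (Kind × Clause)

resolvent-mono : ∀ {Δ Δ′ R} → Δ ⊆ Δ′ → Resolvent Δ R → Resolvent Δ′ R
resolvent-mono Δ⊆Δ′ (C , D , x , (C′ , C′∈ , C′≈) , (D′ , D′∈ , D′≈) , rest) =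
  C , D , x , (C′ , Δ⊆Δ′ C′∈ , C′≈) , (D′ , Δ⊆Δ′ D′∈ , D′≈) , rest

weakening-mono : ∀ {Δ Δ′ D} → Δ ⊆ Δ′ → Weakening Δ D → Weakening Δ′ D
weakening-mono Δ⊆Δ′ (isClause , C , C∈ , C⊆D) = isClause , C , Δ⊆Δ′ C∈ , C⊆D

SBC-antimono : ∀ {Δ Δ′ C} → Δ′ ⊆ Δ → SBC Δ C → SBC Δ′ C
SBC-antimono Δ′⊆Δ (isClause , L , nonempty , L⊆C , blocked) =
  isClause , L , nonempty , L⊆C , λ D D∈ → blocked D (Δ′⊆Δ D∈)

SBCStep : Pred (Kind × Clause) _
SBCStep s = proj₁ s ≡ sbc

SBCStep? : Decidable SBCStep
SBCStep? (sbc  , _) = yes refl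
SBCStep? (res  , _) = no λ ()
SBCStep? (weak , _) = no λ ()

sbcSteps otherSteps : Steps → Steps
sbcSteps   = filter SBCStep?
otherSteps = filter (∁? SBCStep?)

sbcFirst : Steps → Steps
sbcFirst ss = sbcSteps ss ++ otherSteps ss

sbcFirst-SBCFirst : ∀ ss → SBCFirst (sbcFirst ss)
sbcFirst-SBCFirst ss =
  sbcSteps ss , otherSteps ss , refl ,
  all-filter SBCStep? ss , all-filter (∁? SBCStep?) ss

↭-sbcFirst : ∀ ss → ss ↭ sbcFirst ss
↭-sbcFirst [] = ↭-refl
↭-sbcFirst ((sbc  , C) ∷ ss) = ↭-prep _ (↭-sbcFirst ss)
↭-sbcFirst ((res  , C) ∷ ss) =
  ↭-trans (↭-prep _ (↭-sbcFirst ss)) (↭-sym (shift _ (sbcSteps ss) (otherSteps ss)))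
↭-sbcFirst ((weak , C) ∷ ss) =
  ↭-trans (↭-prep _ (↭-sbcFirst ss)) (↭-sym (shift _ (sbcSteps ss) (otherSteps ss)))

added-↭ : ∀ {xs ys : Steps} → xs ↭ ys → added xs ↭ added ys
added-↭ _↭_.refl         = ↭-refl
added-↭ (_↭_.prep _ p)   = ↭-prep _ (added-↭ p)
added-↭ (_↭_.swap _ _ p) = ↭-swap _ _ (added-↭ p)
added-↭ (_↭_.trans p q)  = ↭-trans (added-↭ p) (added-↭ q)

-- A derivation of xs from Δ ends at the formula  added xs ʳ++ Δ.
derivation-++ : ∀ {Δ xs ys} → Derivation Δ xs → Derivation (added xs ʳ++ Δ) ys →
                Derivation Δ (xs ++ ys)
derivation-++ done         d′ = d′
derivation-++ (step s d)   d′ = step s (derivation-++ d d′)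

xs⊆xsʳ++ys : ∀ {A : Set} (xs ys : List A) → xs ⊆ xs ʳ++ ys
xs⊆xsʳ++ys xs ys = ⊆-trans (xs⊆xs++ys xs ys) (⊆-reflexive-↭ (++↭ʳ++ xs ys))

ys⊆xsʳ++ys : ∀ {A : Set} (xs ys : List A) → ys ⊆ xs ʳ++ ys
ys⊆xsʳ++ys xs ys = ⊆-trans (xs⊆ys++xs ys xs) (⊆-reflexive-↭ (++↭ʳ++ xs ys))

sbcSteps-derivation : ∀ {Δ ss} → Derivation Δ ss →
                      ∀ {Δ′} → Δ′ ⊆ Δ → Derivation Δ′ (sbcSteps ss)
sbcSteps-derivation done _ = done
sbcSteps-derivation (step {k = sbc} s d) Δ′⊆Δ =
  step (SBC-antimono Δ′⊆Δ s) (sbcSteps-derivation d (∷⁺ʳ _ Δ′⊆Δ))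
sbcSteps-derivation (step {k = res}  _ d) Δ′⊆Δ =
  sbcSteps-derivation d (⊆-trans Δ′⊆Δ (xs⊆x∷xs _ _))
sbcSteps-derivation (step {k = weak} _ d) Δ′⊆Δ =
  sbcSteps-derivation d (⊆-trans Δ′⊆Δ (xs⊆x∷xs _ _))

otherSteps-derivation : ∀ {Δ ss} → Derivation Δ ss →
                        ∀ {Δ′} → Δ ⊆ Δ′ → added (sbcSteps ss) ⊆ Δ′ →
                        Derivation Δ′ (otherSteps ss)
otherSteps-derivation done _ _ = done
otherSteps-derivation (step {k = sbc} _ d) Δ⊆Δ′ sbcs⊆Δ′ =
  otherSteps-derivation d (∈-∷⁺ʳ (sbcs⊆Δ′ (here refl)) Δ⊆Δ′)
                          (⊆-trans (xs⊆x∷xs _ _) sbcs⊆Δ′)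
otherSteps-derivation (step {k = res} s d) Δ⊆Δ′ sbcs⊆Δ′ =
  step (resolvent-mono Δ⊆Δ′ s)
       (otherSteps-derivation d (∷⁺ʳ _ Δ⊆Δ′) (⊆-trans sbcs⊆Δ′ (xs⊆x∷xs _ _)))
otherSteps-derivation (step {k = weak} s d) Δ⊆Δ′ sbcs⊆Δ′ =
  step (weakening-mono Δ⊆Δ′ s)
       (otherSteps-derivation d (∷⁺ʳ _ Δ⊆Δ′) (⊆-trans sbcs⊆Δ′ (xs⊆x∷xs _ _)))

sbcFirst-derivation : ∀ {Γ ss} → Derivation Γ ss → Derivation Γ (sbcFirst ss)
sbcFirst-derivation {Γ} {ss} d =
  derivation-++ (sbcSteps-derivation d ⊆-refl)
                (otherSteps-derivation d (ys⊆xsʳ++ys (added (sbcSteps ss)) Γ)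
                                         (xs⊆xsʳ++ys (added (sbcSteps ss)) Γ))

lemma15 : (Γ : Formula) → All IsClause Γ → (N : ℕ) →
    (∃[ ss ] (IsSBC⁻Proof Γ ss × size ss ≡ N)) →
    ∃[ ss′ ] (IsSBC⁻Proof Γ ss′ × size ss′ ≤ N × SBCFirst ss′)
lemma15 Γ _ N (ss , ((d , (D , D∈ , D≈[])) , vars) , size≡N) =
  sbcFirst ss ,
  ((sbcFirst-derivation d , (D , ∈-resp-↭ addedΓ-↭ D∈ , D≈[])) , All-resp-↭ same-added vars) ,
  ≤-reflexive (trans (cong suc (sym (↭-length (↭-sbcFirst ss)))) size≡N) ,
  sbcFirst-SBCFirst ss
  where
  same-added : added ss ↭ added (sbcFirst ss)
  same-added = added-↭ (↭-sbcFirst ss)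
  addedΓ-↭ : added ss ++ Γ ↭ added (sbcFirst ss) ++ Γ
  addedΓ-↭ = ++⁺ʳ Γ same-added
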